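{- For nonnegative integers $r,q$, \[ \sum_{\substack{s_1+\cdots+s_{r+2}=q\\ s_i\ge0}}\eta(s_1+1,s_2+1,\ldots,s_{r+2}+1)=\sum_{\substack{\alpha_1+\cdots+\alpha_{q+1}=r\\ \alpha_i\ge0}}\rho(\alpha_1+1,\ldots,\alpha_q+1,\alpha_{q+1}+2). \]
   Context: For positive integers $\beta_1,\ldots,\beta_k$ with $\beta_1+\cdots+\beta_k>1$, the multiple $\eta$-value is $\eta(\beta_1,\ldots,\beta_k)=\sum_{n=1}^\infty\frac{1}{n^{\beta_1}(n+1)^{\beta_2}\cdots(n+k-1)^{\beta_k}}$. The rising factorial is $(x)_0=1$, $(x)_n=x(x+1)\cdots(x+n-1)$. For nonnegative integers $\alpha_1,\ldots,\alpha_k$ with $\alpha_k\ge1$, the multiple $\rho$-value is \[ \rho(\alpha_1+1,\ldots,\alpha_k+1)=\sum_{1\le n_1<\cdots<n_k}\prod_{j=1}^{k}\frac{1}{(n_j+\alpha_1+\cdots+\alpha_{j-1})_{\alpha_j+1}}. \] -}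

module Defs where

open import Data.Nat as ℕ using (ℕ; zero; suc)
open import Data.List using (List; []; _∷_; map; concatMap)
open import Data.Integer using (ℤ; +_)
open import Data.Rational using (ℚ; 0ℚ; _/_) renaming (_+_ to _+ℚ_; _*_ to _*ℚ_)

-- reciprocal of a positive natural (only ever applied to positive arguments)
inv : ℕ → ℚ
inv zero    = 0ℚ
inv (suc k) = (+ 1) / suc k

sumℚ : List ℚ → ℚ
sumℚ []       = 0ℚ
sumℚ (x ∷ xs) = x +ℚ sumℚ xs

rising : ℕ → ℕ → ℕ
rising x zero    = 1
rising x (suc n) = x ℕ.* rising (suc x) n

-- [a, a+1, ..., b]  (empty if b < a)
range : ℕ → ℕ → List ℕ
range a b = go a (suc b ℕ.∸ a)
  where
  go : ℕ → ℕ → List ℕ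
  go a zero    = []
  go a (suc k) = a ∷ go (suc a) k

comps : ℕ → ℕ → List (List ℕ)
comps zero    zero    = [] ∷ []
comps zero    (suc q) = []
comps (suc m) q = concatMap (λ s → map (s ∷_) (comps m (q ℕ.∸ s))) (range 0 q)

etaDen : ℕ → List ℕ → ℕ
etaDen n []       = 1
etaDen n (b ∷ bs) = (n ℕ.^ b) ℕ.* etaDen (suc n) bs

etaPartial : List ℕ → ℕ → ℚ
etaPartial bs N = sumℚ (map (λ n → inv (etaDen n bs)) (range 1 N))

-- rhoAux as off lb N : sum over lb ≤ n_1 < ... < n_k ≤ N of
--   ∏_j 1 / (n_j + off + α_1 + ... + α_{j-1})_{α_j + 1}
rhoAux : List ℕ → ℕ → ℕ → ℕ → ℚ
rhoAux []       off lb N = (+ 1) / 1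
rhoAux (a ∷ as) off lb N =
  sumℚ (map (λ n → inv (rising (n ℕ.+ off) (suc a)) *ℚ rhoAux as (off ℕ.+ a) (suc n) N)
            (range lb N))

-- rhoPartial (α₁,...,α_k) N : partial sum (n_k ≤ N) of ρ(α₁+1,...,α_k+1)
-- (argument list is the α's, i.e. each ρ-argument minus one)
rhoPartial : List ℕ → ℕ → ℚ
rhoPartial as N = rhoAux as 0 1 N

incLast : List ℕ → List ℕ
incLast []           = []
incLast (a ∷ [])     = suc a ∷ []
incLast (a ∷ b ∷ as) = a ∷ incLast (b ∷ as)

lhsPartial : ℕ → ℕ → ℕ → ℚ
lhsPartial r q N = sumℚ (map (λ s → etaPartial (map suc s) N) (comps (suc (suc r)) q))

rhsPartial : ℕ → ℕ → ℕ → ℚ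
rhsPartial r q N = sumℚ (map (λ a → rhoPartial (incLast a) N) (comps (suc q) r))

-- Both sides are increasing partial sums with the same supremum L = E_{r+1,q}(1)/(r+1), where
-- E_{m,q}(n) = ∑_{s₁+⋯+s_m=q} ∏_{j<m} (n+j)^-(s_{j+1}+1); hence every partial sum of either side is
-- within ε of some partial sum of the other.
--
-- η side: comparing the first and the last factor of the denominators gives the partial fraction
-- identity m·E_{m+1,q}(n) = E_{m,q}(n) − E_{m,q}(n+1), so ∑_{n≤N} E_{r+2,q}(n) telescopes to
-- (E_{r+1,q}(1) − E_{r+1,q}(N+1))/(r+1), and E_{r+1,q}(N+1) = O(1/N).
--
-- ρ side: fixing n₁ and α₁ = s leaves a ρ-sum of the same shape with one argument fewer. Since
-- (y)_{s+1} (y+s+1)_{r−s+1} = (y)_{r+2} and ∑_{n>l} 1/(n)_{r+2} = 1/((r+1)(l+1)_{r+1}), induction on q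
-- shows that the sum over n₁ > l tends to c_{r,q}/(l+1)_{r+1}, where c_{r,0} = 1/(r+1) and
-- c_{r,q+1} = (∑_{s≤r} c_{r−s,q})/(r+1). The last-factor identity shows that r!·E_{r+1,q}(1) obeys the
-- same recursion, so c_{r,q}/(r+1)! = L.

module Submission where

open import Data.Nat using (ℕ)
open import Data.Product using (_×_; ∃-syntax)
open import Data.Rational using (ℚ; 0ℚ; _<_; _≤_; _+_)

open import Defs
open import Data.Nat as ℕ using (zero; suc; z≤n; s≤s)
import Data.Nat.Properties as ℕP
import Data.Nat.Coprimality as Coprime
open import Data.Integer as ℤ using (+_; -[1+_])
import Data.Integer.Properties as ℤP
open import Data.Integer.Solver renaming (module +-*-Solver to ℤ-Solver)
open import Data.Rational as ℚ using (1ℚ; mkℚ; _*_; _-_)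
import Data.Rational.Properties as ℚP
import Data.Rational.Unnormalised as ℚᵘ
import Data.Rational.Unnormalised.Properties as ℚᵘP
open import Data.Rational.Solver renaming (module +-*-Solver to ℚ-Solver)
open import Data.List using (List; []; _∷_; map; concatMap; _++_; length)
import Data.List.Properties as List
open import Data.List.Relation.Unary.All as All using (All; []; _∷_)
import Data.List.Relation.Unary.All.Properties as All
open import Data.Product using (_,_; proj₁; proj₂)
open import Relation.Binary.PropositionalEquality
open import Function using (_∘_)

private variable A B : Set

fromℕ : ℕ → ℚ
fromℕ n = mkℚ (+ n) 0 (Coprime.sym (Coprime.1-coprimeTo n))

fromℕ-suc : ∀ n → fromℕ (suc n) ≡ 1ℚ + fromℕ n
fromℕ-suc n = ℚP.toℚᵘ-injective (ℚᵘP.≃-sym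
  (ℚᵘP.≃-trans (ℚP.toℚᵘ-homo-+ 1ℚ (fromℕ n)) (ℚᵘ.*≡* (cross-multiplied (+ n)))))
  where
  open ℤ-Solver
  cross-multiplied : ∀ x → ((+ 1 ℤ.* + 1) ℤ.+ (x ℤ.* + 1)) ℤ.* + 1 ≡ (+ 1 ℤ.+ x) ℤ.* (+ 1 ℤ.* + 1)
  cross-multiplied = solve 1 (λ x → ((con (+ 1) :* con (+ 1)) :+ (x :* con (+ 1))) :* con (+ 1)
                                    := (con (+ 1) :+ x) :* (con (+ 1) :* con (+ 1))) refl

fromℕ-+ : ∀ m n → fromℕ (m ℕ.+ n) ≡ fromℕ m + fromℕ n
fromℕ-+ zero    n = sym (ℚP.+-identityˡ (fromℕ n))
fromℕ-+ (suc m) n = begin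
  fromℕ (suc (m ℕ.+ n))       ≡⟨ fromℕ-suc (m ℕ.+ n) ⟩
  1ℚ + fromℕ (m ℕ.+ n)        ≡⟨ cong (λ z → 1ℚ + z) (fromℕ-+ m n) ⟩
  1ℚ + (fromℕ m + fromℕ n)    ≡⟨ ℚP.+-assoc 1ℚ (fromℕ m) (fromℕ n) ⟨
  (1ℚ + fromℕ m) + fromℕ n    ≡⟨ cong (_+ fromℕ n) (fromℕ-suc m) ⟨
  fromℕ (suc m) + fromℕ n     ∎
  where open ≡-Reasoning

fromℕ-* : ∀ m n → fromℕ (m ℕ.* n) ≡ fromℕ m * fromℕ n
fromℕ-* zero    n = sym (ℚP.*-zeroˡ (fromℕ n))
fromℕ-* (suc m) n = begin
  fromℕ (n ℕ.+ m ℕ.* n)            ≡⟨ fromℕ-+ n (m ℕ.* n) ⟩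
  fromℕ n + fromℕ (m ℕ.* n)        ≡⟨ cong (λ z → fromℕ n + z) (fromℕ-* m n) ⟩
  fromℕ n + fromℕ m * fromℕ n      ≡⟨ solve 2 (λ a b → a :+ b :* a := (con 1ℚ :+ b) :* a) refl (fromℕ n) (fromℕ m) ⟩
  (1ℚ + fromℕ m) * fromℕ n         ≡⟨ cong (_* fromℕ n) (fromℕ-suc m) ⟨
  fromℕ (suc m) * fromℕ n          ∎
  where open ≡-Reasoning; open ℚ-Solver

fromℕ-mono-≤ : ∀ {m n} → m ℕ.≤ n → fromℕ m ≤ fromℕ n
fromℕ-mono-≤ {m} {n} m≤n =
  ℚ.*≤* (subst₂ ℤ._≤_ (sym (ℤP.*-identityʳ (+ m))) (sym (ℤP.*-identityʳ (+ n))) (ℤ.+≤+ m≤n))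

fromℕ-nonNeg : ∀ n → 0ℚ ≤ fromℕ n
fromℕ-nonNeg n = fromℕ-mono-≤ z≤n

inv-suc : ∀ k → inv (suc k) ≡ mkℚ (+ 1) k (Coprime.1-coprimeTo (suc k))
inv-suc k = ℚP.normalize-coprime (Coprime.1-coprimeTo (suc k))

inv-inverseˡ : ∀ k → inv (suc k) * fromℕ (suc k) ≡ 1ℚ
inv-inverseˡ k rewrite inv-suc k = ℚP.*-inverseˡ (fromℕ (suc k))

inv-inverseʳ : ∀ k → fromℕ (suc k) * inv (suc k) ≡ 1ℚ
inv-inverseʳ k = trans (ℚP.*-comm (fromℕ (suc k)) (inv (suc k))) (inv-inverseˡ k)

*-inverseˡ-unique : ∀ x y c → x * c ≡ 1ℚ → y * c ≡ 1ℚ → x ≡ y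
*-inverseˡ-unique x y c xc≡1 yc≡1 = begin
  x            ≡⟨ ℚP.*-identityʳ x ⟨
  x * 1ℚ       ≡⟨ cong (x *_) yc≡1 ⟨
  x * (y * c)  ≡⟨ solve 3 (λ x y c → x :* (y :* c) := y :* (x :* c)) refl x y c ⟩
  y * (x * c)  ≡⟨ cong (y *_) xc≡1 ⟩
  y * 1ℚ       ≡⟨ ℚP.*-identityʳ y ⟩
  y            ∎
  where open ≡-Reasoning; open ℚ-Solver

inv-* : ∀ a b → inv (a ℕ.* b) ≡ inv a * inv b
inv-* zero    b    = sym (ℚP.*-zeroˡ (inv b))
inv-* (suc a) zero rewrite ℕP.*-zeroʳ a = sym (ℚP.*-zeroʳ (inv (suc a)))
inv-* (suc a) (suc b) =
  *-inverseˡ-unique _ _ (fromℕ (suc a ℕ.* suc b)) (inv-inverseˡ (b ℕ.+ a ℕ.* suc b)) product-inverse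
  where
  open ≡-Reasoning; open ℚ-Solver
  x = inv (suc a); y = inv (suc b); u = fromℕ (suc a); v = fromℕ (suc b)
  product-inverse : (x * y) * fromℕ (suc a ℕ.* suc b) ≡ 1ℚ
  product-inverse = begin
    (x * y) * fromℕ (suc a ℕ.* suc b)  ≡⟨ cong ((x * y) *_) (fromℕ-* (suc a) (suc b)) ⟩
    (x * y) * (u * v)                  ≡⟨ solve 4 (λ x y u v → (x :* y) :* (u :* v) := (x :* u) :* (y :* v)) refl x y u v ⟩
    (x * u) * (y * v)                  ≡⟨ cong₂ _*_ (inv-inverseˡ a) (inv-inverseˡ b) ⟩
    1ℚ                                 ∎

fromℕ*inv-cancelˡ : ∀ y z → fromℕ (suc y) * inv (suc y ℕ.* z) ≡ inv z
fromℕ*inv-cancelˡ y z = begin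
  fromℕ (suc y) * inv (suc y ℕ.* z)         ≡⟨ cong (fromℕ (suc y) *_) (inv-* (suc y) z) ⟩
  fromℕ (suc y) * (inv (suc y) * inv z)     ≡⟨ ℚP.*-assoc (fromℕ (suc y)) (inv (suc y)) (inv z) ⟨
  (fromℕ (suc y) * inv (suc y)) * inv z     ≡⟨ cong (_* inv z) (inv-inverseʳ y) ⟩
  1ℚ * inv z                                ≡⟨ ℚP.*-identityˡ (inv z) ⟩
  inv z                                     ∎
  where open ≡-Reasoning

fromℕ*a≡b⇒a≡inv*b : ∀ r a b → fromℕ (suc r) * a ≡ b → a ≡ inv (suc r) * b
fromℕ*a≡b⇒a≡inv*b r a b eq = begin
  a                                   ≡⟨ ℚP.*-identityˡ a ⟨
  1ℚ * a                              ≡⟨ cong (_* a) (inv-inverseˡ r) ⟨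
  (inv (suc r) * fromℕ (suc r)) * a   ≡⟨ ℚP.*-assoc (inv (suc r)) (fromℕ (suc r)) a ⟩
  inv (suc r) * (fromℕ (suc r) * a)   ≡⟨ cong (inv (suc r) *_) eq ⟩
  inv (suc r) * b                     ∎
  where open ≡-Reasoning

*-monoˡ-≤-0≤ : ∀ c {a b} → 0ℚ ≤ c → a ≤ b → c * a ≤ c * b
*-monoˡ-≤-0≤ c 0≤c a≤b = ℚP.*-monoˡ-≤-nonNeg c {{ℚ.nonNegative 0≤c}} a≤b

*-monoʳ-≤-0≤ : ∀ c {a b} → 0ℚ ≤ c → a ≤ b → a * c ≤ b * c
*-monoʳ-≤-0≤ c 0≤c a≤b = ℚP.*-monoʳ-≤-nonNeg c {{ℚ.nonNegative 0≤c}} a≤b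

*-0≤ : ∀ {a b} → 0ℚ ≤ a → 0ℚ ≤ b → 0ℚ ≤ a * b
*-0≤ {a} {b} 0≤a 0≤b = subst (_≤ a * b) (ℚP.*-zeroʳ a) (*-monoˡ-≤-0≤ a 0≤a 0≤b)

*-0< : ∀ {a b} → 0ℚ < a → 0ℚ < b → 0ℚ < a * b
*-0< {a} {b} 0<a 0<b = ℚP.positive⁻¹ (a * b) {{ℚP.pos*pos⇒pos a {{ℚ.positive 0<a}} b {{ℚ.positive 0<b}}}}

a-b≤a : ∀ a {b} → 0ℚ ≤ b → a - b ≤ a
a-b≤a a {b} 0≤b = subst (a - b ≤_) (ℚP.+-identityʳ a) (ℚP.+-monoʳ-≤ a (ℚP.neg-antimono-≤ 0≤b))

inv-nonNeg : ∀ k → 0ℚ ≤ inv k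
inv-nonNeg zero    = ℚP.≤-refl
inv-nonNeg (suc k) rewrite inv-suc k = ℚ.*≤* (ℤ.+≤+ z≤n)

inv-pos : ∀ k → 0ℚ < inv (suc k)
inv-pos k rewrite inv-suc k = ℚ.*<* (ℤ.+<+ (s≤s z≤n))

inv-antimono-≤ : ∀ {a b} → a ℕ.≤ b → inv (suc b) ≤ inv (suc a)
inv-antimono-≤ {a} {b} a≤b rewrite inv-suc a | inv-suc b =
  ℚ.*≤* (subst₂ ℤ._≤_ (sym (ℤP.*-identityˡ (+ suc a))) (sym (ℤP.*-identityˡ (+ suc b))) (ℤ.+≤+ (s≤s a≤b)))

inv≤1 : ∀ k → inv k ≤ 1ℚ
inv≤1 zero    = ℚ.*≤* (ℤ.+≤+ z≤n)
inv≤1 (suc k) = inv-antimono-≤ {0} {k} z≤n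

inv-*≤ : ∀ y z → inv (suc y ℕ.* z) ≤ inv (suc y)
inv-*≤ y z = begin
  inv (suc y ℕ.* z)        ≡⟨ inv-* (suc y) z ⟩
  inv (suc y) * inv z      ≤⟨ *-monoˡ-≤-0≤ (inv (suc y)) (inv-nonNeg (suc y)) (inv≤1 z) ⟩
  inv (suc y) * 1ℚ         ≡⟨ ℚP.*-identityʳ (inv (suc y)) ⟩
  inv (suc y)              ∎
  where open ℚP.≤-Reasoning

fromℕ*inv-suc≤1 : ∀ n → fromℕ n * inv (suc n) ≤ 1ℚ
fromℕ*inv-suc≤1 n = ℚP.≤-trans (*-monoʳ-≤-0≤ (inv (suc n)) (inv-nonNeg (suc n)) (fromℕ-mono-≤ (ℕP.n≤1+n n)))
                               (ℚP.≤-reflexive (inv-inverseʳ n))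

∑ : List A → (A → ℚ) → ℚ
∑ xs f = sumℚ (map f xs)

sumℚ-++ : ∀ xs ys → sumℚ (xs ++ ys) ≡ sumℚ xs + sumℚ ys
sumℚ-++ []       ys = sym (ℚP.+-identityˡ (sumℚ ys))
sumℚ-++ (x ∷ xs) ys = trans (cong (λ z → x + z) (sumℚ-++ xs ys)) (sym (ℚP.+-assoc x (sumℚ xs) (sumℚ ys)))

∑-++ : ∀ (xs ys : List A) (f : A → ℚ) → ∑ (xs ++ ys) f ≡ ∑ xs f + ∑ ys f
∑-++ xs ys f = trans (cong sumℚ (List.map-++ f xs ys)) (sumℚ-++ (map f xs) (map f ys))

∑-cong : ∀ (xs : List A) {f g} → (∀ x → f x ≡ g x) → ∑ xs f ≡ ∑ xs g
∑-cong []       f≗g = refl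
∑-cong (x ∷ xs) f≗g = cong₂ _+_ (f≗g x) (∑-cong xs f≗g)

∑-congᴬ : ∀ {xs : List A} {f g} → All (λ x → f x ≡ g x) xs → ∑ xs f ≡ ∑ xs g
∑-congᴬ []         = refl
∑-congᴬ (eq ∷ eqs) = cong₂ _+_ eq (∑-congᴬ eqs)

∑-distrib-+ : ∀ (xs : List A) (f g : A → ℚ) → ∑ xs (λ x → f x + g x) ≡ ∑ xs f + ∑ xs g
∑-distrib-+ []       f g = refl
∑-distrib-+ (x ∷ xs) f g = trans (cong (λ z → (f x + g x) + z) (∑-distrib-+ xs f g))
  (solve 4 (λ a b c d → (a :+ b) :+ (c :+ d) := (a :+ c) :+ (b :+ d)) refl (f x) (g x) (∑ xs f) (∑ xs g))
  where open ℚ-Solver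

∑-distribˡ-* : ∀ (xs : List A) c (f : A → ℚ) → ∑ xs (λ x → c * f x) ≡ c * ∑ xs f
∑-distribˡ-* []       c f = sym (ℚP.*-zeroʳ c)
∑-distribˡ-* (x ∷ xs) c f =
  trans (cong (λ z → c * f x + z) (∑-distribˡ-* xs c f)) (sym (ℚP.*-distribˡ-+ c (f x) (∑ xs f)))

∑-distribʳ-* : ∀ (xs : List A) c (f : A → ℚ) → ∑ xs (λ x → f x * c) ≡ ∑ xs f * c
∑-distribʳ-* xs c f = begin
  ∑ xs (λ x → f x * c)  ≡⟨ ∑-cong xs (λ x → ℚP.*-comm (f x) c) ⟩
  ∑ xs (λ x → c * f x)  ≡⟨ ∑-distribˡ-* xs c f ⟩
  c * ∑ xs f            ≡⟨ ℚP.*-comm c (∑ xs f) ⟩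
  ∑ xs f * c            ∎
  where open ≡-Reasoning

∑-zero : ∀ (xs : List A) → ∑ xs (λ _ → 0ℚ) ≡ 0ℚ
∑-zero []       = refl
∑-zero (x ∷ xs) = cong (λ z → 0ℚ + z) (∑-zero xs)

∑-map : ∀ (xs : List A) (h : A → B) (f : B → ℚ) → ∑ (map h xs) f ≡ ∑ xs (f ∘ h)
∑-map xs h f = cong sumℚ (sym (List.map-∘ xs))

∑-concatMap : ∀ (xs : List A) (g : A → List B) (f : B → ℚ) → ∑ (concatMap g xs) f ≡ ∑ xs (λ x → ∑ (g x) f)
∑-concatMap []       g f = refl
∑-concatMap (x ∷ xs) g f = trans (∑-++ (g x) (concatMap g xs) f) (cong (λ z → ∑ (g x) f + z) (∑-concatMap xs g f))

∑-comm : ∀ (xs : List A) (ys : List B) (f : A → B → ℚ) →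
         ∑ xs (λ x → ∑ ys (λ y → f x y)) ≡ ∑ ys (λ y → ∑ xs (λ x → f x y))
∑-comm []       ys f = sym (∑-zero ys)
∑-comm (x ∷ xs) ys f = trans (cong (λ z → ∑ ys (f x) + z) (∑-comm xs ys f))
                             (sym (∑-distrib-+ ys (f x) (λ y → ∑ xs (λ x → f x y))))

∑-monoᴬ : ∀ {xs : List A} {f g} → All (λ x → f x ≤ g x) xs → ∑ xs f ≤ ∑ xs g
∑-monoᴬ []         = ℚP.≤-refl
∑-monoᴬ (le ∷ les) = ℚP.+-mono-≤ le (∑-monoᴬ les)

∑-mono : ∀ (xs : List A) {f g} → (∀ x → f x ≤ g x) → ∑ xs f ≤ ∑ xs g
∑-mono xs f≤g = ∑-monoᴬ (All.universal f≤g xs)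

∑-nonNeg : ∀ (xs : List A) {f} → (∀ x → 0ℚ ≤ f x) → 0ℚ ≤ ∑ xs f
∑-nonNeg []       0≤f = ℚP.≤-refl
∑-nonNeg (x ∷ xs) 0≤f = ℚP.+-mono-≤ (0≤f x) (∑-nonNeg xs 0≤f)

∑≤length* : ∀ (xs : List A) {f} c → All (λ x → f x ≤ c) xs → ∑ xs f ≤ fromℕ (length xs) * c
∑≤length* []       c []         = ℚP.≤-reflexive (sym (ℚP.*-zeroˡ c))
∑≤length* (x ∷ xs) c (le ∷ les) = ℚP.≤-trans (ℚP.+-mono-≤ le (∑≤length* xs c les)) (ℚP.≤-reflexive (begin
  c + fromℕ (length xs) * c   ≡⟨ solve 2 (λ c a → c :+ a :* c := (con 1ℚ :+ a) :* c) refl c (fromℕ (length xs)) ⟩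
  (1ℚ + fromℕ (length xs)) * c ≡⟨ cong (_* c) (fromℕ-suc (length xs)) ⟨
  fromℕ (suc (length xs)) * c  ∎))
  where open ≡-Reasoning; open ℚ-Solver

-- `range` recurses through a local helper indexed by the length, so we compute with the
-- explicit enumeration countFrom a k = [a, a+1, …, a+k−1] instead.
countFrom : ℕ → ℕ → List ℕ
countFrom a zero    = []
countFrom a (suc k) = a ∷ countFrom (suc a) k

range≡countFrom : ∀ a b → range a b ≡ countFrom a (suc b ℕ.∸ a)
range≡countFrom a b = go (suc b ℕ.∸ a) a b refl
  where
  ∸-pred : ∀ b a k → suc b ℕ.∸ a ≡ suc k → b ℕ.∸ a ≡ k
  ∸-pred b       zero    k eq = ℕP.suc-injective eq
  ∸-pred zero    (suc a) k eq with () ← trans (sym (ℕP.0∸n≡0 a)) eq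
  ∸-pred (suc b) (suc a) k eq = ∸-pred b a k eq
  range-cons : ∀ a b k → suc b ℕ.∸ a ≡ suc k → range a b ≡ a ∷ range (suc a) b
  range-cons a b k eq rewrite eq | sym (∸-pred b a k eq) = refl
  go : ∀ k a b → suc b ℕ.∸ a ≡ k → range a b ≡ countFrom a k
  go zero    a b eq rewrite eq = refl
  go (suc k) a b eq = trans (range-cons a b k eq) (cong (a ∷_) (go k (suc a) b (∸-pred b a k eq)))

countFrom-suc : ∀ a k → countFrom (suc a) k ≡ map suc (countFrom a k)
countFrom-suc a zero    = refl
countFrom-suc a (suc k) = cong (suc a ∷_) (countFrom-suc (suc a) k)

countFrom-snoc : ∀ a k → countFrom a (suc k) ≡ countFrom a k ++ (a ℕ.+ k ∷ [])
countFrom-snoc a zero    = cong (_∷ []) (sym (ℕP.+-identityʳ a))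
countFrom-snoc a (suc k) = cong (a ∷_) (trans (countFrom-snoc (suc a) k)
                                              (cong (λ z → countFrom (suc a) k ++ (z ∷ [])) (sym (ℕP.+-suc a k))))

countFrom-bounded : ∀ a k → All (ℕ._< a ℕ.+ k) (countFrom a k)
countFrom-bounded a zero    = []
countFrom-bounded a (suc k) = ℕP.m<m+n a (s≤s z≤n)
  ∷ All.map (λ {n} → subst (n ℕ.<_) (sym (ℕP.+-suc a k))) (countFrom-bounded (suc a) k)

range0-bounded : ∀ r → All (ℕ._≤ r) (range 0 r)
range0-bounded r rewrite range≡countFrom 0 r = All.map ℕP.≤-pred (countFrom-bounded 0 (suc r))

range0-suc : ∀ r → range 0 (suc r) ≡ 0 ∷ map suc (range 0 r)
range0-suc r = begin
  range 0 (suc r)                 ≡⟨ range≡countFrom 0 (suc r) ⟩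
  0 ∷ countFrom 1 (suc r)         ≡⟨ cong (0 ∷_) (countFrom-suc 0 (suc r)) ⟩
  0 ∷ map suc (countFrom 0 (suc r)) ≡⟨ cong (λ ns → 0 ∷ map suc ns) (range≡countFrom 0 r) ⟨
  0 ∷ map suc (range 0 r)         ∎
  where open ≡-Reasoning

∑-telescoping : ∀ (f : ℕ → ℚ) a k → ∑ (countFrom a k) (λ n → f n - f (suc n)) ≡ f a - f (a ℕ.+ k)
∑-telescoping f a zero    rewrite ℕP.+-identityʳ a = sym (ℚP.+-inverseʳ (f a))
∑-telescoping f a (suc k) rewrite ℕP.+-suc a k = trans (cong (λ z → (f a - f (suc a)) + z) (∑-telescoping f (suc a) k))
  (solve 3 (λ x y z → (x :- y) :+ (y :- z) := x :- z) refl (f a) (f (suc a)) (f (suc a ℕ.+ k)))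
  where open ℚ-Solver

∑-range-monoʳ : ∀ (f : ℕ → ℚ) → (∀ n → 0ℚ ≤ f n) → ∀ a {K N} → K ℕ.≤ N →
                ∑ (range a K) f ≤ ∑ (range a N) f
∑-range-monoʳ f 0≤f a {K} {N} K≤N rewrite range≡countFrom a K | range≡countFrom a N =
  prefix a (ℕP.∸-monoˡ-≤ a (s≤s K≤N))
  where
  prefix : ∀ a {k k′} → k ℕ.≤ k′ → ∑ (countFrom a k) f ≤ ∑ (countFrom a k′) f
  prefix a {zero}  {k′}    _         = ∑-nonNeg (countFrom a k′) 0≤f
  prefix a {suc k} {suc k′} (s≤s k≤k′) = ℚP.+-monoʳ-≤ (f a) (prefix (suc a) k≤k′)

Eventually : (ℕ → Set) → Set
Eventually P = ∃[ N₀ ] (∀ N → N₀ ℕ.≤ N → P N)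

eventually-All : ∀ (P : A → ℕ → Set) xs → (∀ x → Eventually (P x)) → Eventually (λ N → All (λ x → P x N) xs)
eventually-All P []       ev = 0 , λ _ _ → []
eventually-All P (x ∷ xs) ev with ev x | eventually-All P xs ev
... | N₁ , Px | N₂ , Pxs = N₁ ℕ.⊔ N₂ , λ N N₁⊔N₂≤N →
  Px N (ℕP.≤-trans (ℕP.m≤m⊔n N₁ N₂) N₁⊔N₂≤N) ∷ Pxs N (ℕP.≤-trans (ℕP.m≤n⊔m N₁ N₂) N₁⊔N₂≤N)

ceiling : ∀ p → ∃[ B ] p ≤ fromℕ B
ceiling (mkℚ (+ k) d _) = k , ℚ.*≤* (subst₂ ℤ._≤_ (ℤP.pos-* k 1) (ℤP.pos-* k (suc d))
                                               (ℤ.+≤+ (ℕP.*-monoʳ-≤ k (s≤s z≤n))))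
ceiling (mkℚ -[1+ k ] d _) = 0 , ℚ.*≤* (subst (ℤ._≤ + 0) (sym (ℤP.*-identityʳ -[1+ k ])) ℤ.-≤+)

eventually-inv≤ : ∀ δ → 0ℚ < δ → Eventually (λ N → inv (suc N) ≤ δ)
eventually-inv≤ (mkℚ (+ suc n) d c) _ = d , λ N d≤N → ℚP.≤-trans (inv-antimono-≤ d≤N)
  (subst (_≤ mkℚ (+ suc n) d c) (sym (inv-suc d))
    (ℚ.*≤* (subst₂ ℤ._≤_ (ℤP.pos-* 1 (suc d)) (ℤP.pos-* (suc n) (suc d))
                         (ℤ.+≤+ (ℕP.*-monoˡ-≤ (suc d) {1} {suc n} (s≤s z≤n))))))
eventually-inv≤ (mkℚ (+ zero) d c) (ℚ.*<* (ℤ.+<+ ()))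
eventually-inv≤ (mkℚ -[1+ n ] d c) (ℚ.*<* ())

-- With C ≤ B and 1/(1 + K) ≤ δ, the witness satisfies 1 + N₀ = (1 + B)(1 + K).
eventually-*inv≤ : ∀ C δ → 0ℚ < δ → Eventually (λ N → C * inv (suc N) ≤ δ)
eventually-*inv≤ C δ 0<δ with ceiling C | eventually-inv≤ δ 0<δ
... | B , C≤B | K , invK≤δ = K ℕ.+ B ℕ.* suc K , λ N N₀≤N → begin
  C * inv (suc N)                            ≤⟨ *-monoʳ-≤-0≤ (inv (suc N)) (inv-nonNeg (suc N)) C≤B ⟩
  fromℕ B * inv (suc N)                      ≤⟨ *-monoˡ-≤-0≤ (fromℕ B) (fromℕ-nonNeg B) (inv-antimono-≤ N₀≤N) ⟩
  fromℕ B * inv (suc B ℕ.* suc K)            ≡⟨ cong (fromℕ B *_) (inv-* (suc B) (suc K)) ⟩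
  fromℕ B * (inv (suc B) * inv (suc K))      ≡⟨ ℚP.*-assoc (fromℕ B) (inv (suc B)) (inv (suc K)) ⟨
  (fromℕ B * inv (suc B)) * inv (suc K)      ≤⟨ *-monoʳ-≤-0≤ (inv (suc K)) (inv-nonNeg (suc K)) (fromℕ*inv-suc≤1 B) ⟩
  1ℚ * inv (suc K)                           ≡⟨ ℚP.*-identityˡ (inv (suc K)) ⟩
  inv (suc K)                                ≤⟨ invK≤δ K ℕP.≤-refl ⟩
  δ                                          ∎
  where open ℚP.≤-Reasoning

small-multiplier : ∀ a δ → 0ℚ < δ → ∃[ η ] (0ℚ < η × η * a ≤ δ)
small-multiplier a δ 0<δ with ceiling a
... | B , a≤B = δ * inv (suc B) , *-0< 0<δ (inv-pos B) , (begin
  (δ * inv (suc B)) * a        ≤⟨ *-monoˡ-≤-0≤ (δ * inv (suc B)) (*-0≤ (ℚP.<⇒≤ 0<δ) (inv-nonNeg (suc B))) a≤B ⟩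
  (δ * inv (suc B)) * fromℕ B  ≡⟨ solve 3 (λ d i b → (d :* i) :* b := d :* (b :* i)) refl δ (inv (suc B)) (fromℕ B) ⟩
  δ * (fromℕ B * inv (suc B))  ≤⟨ *-monoˡ-≤-0≤ δ (ℚP.<⇒≤ 0<δ) (fromℕ*inv-suc≤1 B) ⟩
  δ * 1ℚ                       ≡⟨ ℚP.*-identityʳ δ ⟩
  δ                            ∎)
  where open ℚP.≤-Reasoning; open ℚ-Solver

half : ℚ → ℚ
half ε = ε * inv 2

half-pos : ∀ {ε} → 0ℚ < ε → 0ℚ < half ε
half-pos 0<ε = *-0< 0<ε (inv-pos 1)

half+half : ∀ ε → half ε + half ε ≡ ε
half+half ε = trans (sym (ℚP.*-distribˡ-+ ε (inv 2) (inv 2))) (ℚP.*-identityʳ ε)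

record IsSupremum (f : ℕ → ℚ) (L : ℚ) : Set where
  field
    upperBound   : ∀ N → f N ≤ L
    approximable : ∀ ε → 0ℚ < ε → ∃[ M ] L ≤ f M + ε

≤-supremum+ε : ∀ {f g L} → IsSupremum f L → IsSupremum g L → ∀ ε → 0ℚ < ε → ∀ N → ∃[ M ] f N ≤ g M + ε
≤-supremum+ε f-sup g-sup ε 0<ε N with IsSupremum.approximable g-sup ε 0<ε
... | M , L≤gM+ε = M , ℚP.≤-trans (IsSupremum.upperBound f-sup N) L≤gM+ε

etaTerm : ℕ → ℕ → ℕ → ℚ
etaTerm m q x = ∑ (comps m q) (λ s → inv (etaDen x (map suc s)))

etaTerm-nonNeg : ∀ m q x → 0ℚ ≤ etaTerm m q x
etaTerm-nonNeg m q x = ∑-nonNeg (comps m q) (λ s → inv-nonNeg (etaDen x (map suc s)))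

etaTerm-suc : ∀ m q x → etaTerm (suc m) q x ≡ ∑ (range 0 q) (λ s → inv (x ℕ.^ suc s) * etaTerm m (q ℕ.∸ s) (suc x))
etaTerm-suc m q x = begin
  etaTerm (suc m) q x
    ≡⟨ ∑-concatMap (range 0 q) (λ s → map (s ∷_) (tails s)) term ⟩
  ∑ (range 0 q) (λ s → ∑ (map (s ∷_) (tails s)) term)
    ≡⟨ ∑-cong (range 0 q) (λ s → ∑-map (tails s) (s ∷_) term) ⟩
  ∑ (range 0 q) (λ s → ∑ (tails s) (λ t → inv (x ℕ.^ suc s ℕ.* rest t)))
    ≡⟨ ∑-cong (range 0 q) (λ s → ∑-cong (tails s) (λ t → inv-* (x ℕ.^ suc s) (rest t))) ⟩
  ∑ (range 0 q) (λ s → ∑ (tails s) (λ t → inv (x ℕ.^ suc s) * inv (rest t)))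
    ≡⟨ ∑-cong (range 0 q) (λ s → ∑-distribˡ-* (tails s) (inv (x ℕ.^ suc s)) (inv ∘ rest)) ⟩
  ∑ (range 0 q) (λ s → inv (x ℕ.^ suc s) * etaTerm m (q ℕ.∸ s) (suc x)) ∎
  where
  open ≡-Reasoning
  tails : ℕ → List (List ℕ)
  tails s = comps m (q ℕ.∸ s)
  rest : List ℕ → ℕ
  rest t = etaDen (suc x) (map suc t)
  term : List ℕ → ℚ
  term s = inv (etaDen x (map suc s))

rising-positive : ∀ y n → ∃[ k ] rising (suc y) n ≡ suc k
rising-positive y zero    = 0 , refl
rising-positive y (suc n) with rising-positive (suc y) n
... | k , eq = k ℕ.+ y ℕ.* suc k , cong (suc y ℕ.*_) eq

rising-+ : ∀ y a b → rising y (a ℕ.+ b) ≡ rising y a ℕ.* rising (y ℕ.+ a) b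
rising-+ y zero    b rewrite ℕP.+-identityʳ y = sym (ℕP.*-identityˡ (rising y b))
rising-+ y (suc a) b = begin
  y ℕ.* rising (suc y) (a ℕ.+ b)                      ≡⟨ cong (y ℕ.*_) (rising-+ (suc y) a b) ⟩
  y ℕ.* (rising (suc y) a ℕ.* rising (suc y ℕ.+ a) b) ≡⟨ ℕP.*-assoc y _ _ ⟨
  rising y (suc a) ℕ.* rising (suc y ℕ.+ a) b         ≡⟨ cong (λ z → rising y (suc a) ℕ.* rising z b) (ℕP.+-suc y a) ⟨
  rising y (suc a) ℕ.* rising (y ℕ.+ suc a) b         ∎
  where open ≡-Reasoning

rising-suc-last : ∀ y n → rising y (suc n) ≡ rising y n ℕ.* (y ℕ.+ n)
rising-suc-last y n = begin
  rising y (suc n)                        ≡⟨ cong (rising y) (ℕP.+-comm 1 n) ⟩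
  rising y (n ℕ.+ 1)                      ≡⟨ rising-+ y n 1 ⟩
  rising y n ℕ.* ((y ℕ.+ n) ℕ.* 1)        ≡⟨ cong (rising y n ℕ.*_) (ℕP.*-identityʳ (y ℕ.+ n)) ⟩
  rising y n ℕ.* (y ℕ.+ n)                ∎
  where open ≡-Reasoning

etaTerm-zero : ∀ m x → etaTerm m 0 x ≡ inv (rising x m)
etaTerm-zero zero    x = refl
etaTerm-zero (suc m) x = begin
  etaTerm (suc m) 0 x                       ≡⟨ etaTerm-suc m 0 x ⟩
  inv (x ℕ.^ 1) * etaTerm m 0 (suc x) + 0ℚ  ≡⟨ ℚP.+-identityʳ _ ⟩
  inv (x ℕ.^ 1) * etaTerm m 0 (suc x)       ≡⟨ cong₂ (λ a b → inv a * b) (ℕP.*-identityʳ x) (etaTerm-zero m (suc x)) ⟩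
  inv x * inv (rising (suc x) m)            ≡⟨ inv-* x (rising (suc x) m) ⟨
  inv (rising x (suc m))                    ∎
  where open ≡-Reasoning

comps-one : ∀ k → comps 1 k ≡ (k ∷ []) ∷ []
comps-one k = trans (cong (concatMap (λ s → map (s ∷_) (comps 0 (k ℕ.∸ s)))) (range≡countFrom 0 k)) (go k (λ s → s))
  where
  go : ∀ k (h : ℕ → ℕ) → concatMap (λ s → map (h s ∷_) (comps 0 (k ℕ.∸ s))) (countFrom 0 (suc k)) ≡ (h k ∷ []) ∷ []
  go zero    h = refl
  go (suc k) h = begin
    concatMap single (countFrom 1 (suc k))        ≡⟨ cong (concatMap single) (countFrom-suc 0 (suc k)) ⟩
    concatMap single (map suc (countFrom 0 (suc k))) ≡⟨ List.concatMap-map single suc (countFrom 0 (suc k)) ⟩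
    concatMap (single ∘ suc) (countFrom 0 (suc k)) ≡⟨ go k (h ∘ suc) ⟩
    (h (suc k) ∷ []) ∷ []                          ∎
    where
    open ≡-Reasoning
    single : ℕ → List (List ℕ)
    single s = map (h s ∷_) (comps 0 (suc k ℕ.∸ s))

etaTerm-one : ∀ k x → etaTerm 1 k x ≡ inv (x ℕ.^ suc k)
etaTerm-one k x rewrite comps-one k =
  trans (ℚP.+-identityʳ (inv (x ℕ.^ suc k ℕ.* 1))) (cong inv (ℕP.*-identityʳ (x ℕ.^ suc k)))

delay : (ℕ → ℚ) → ℕ → ℚ
delay g zero    = 0ℚ
delay g (suc k) = g k

∑-convolution-delay : ∀ q (f g : ℕ → ℚ) →
  ∑ (range 0 (suc q)) (λ s → f s * delay g (suc q ℕ.∸ s)) ≡ ∑ (range 0 q) (λ s → f s * g (q ℕ.∸ s))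
∑-convolution-delay q f g = begin
  ∑ (range 0 (suc q)) h                               ≡⟨ cong (λ ns → ∑ ns h) (range≡countFrom 0 (suc q)) ⟩
  ∑ (countFrom 0 (suc (suc q))) h                     ≡⟨ cong (λ ns → ∑ ns h) (countFrom-snoc 0 (suc q)) ⟩
  ∑ (countFrom 0 (suc q) ++ (suc q ∷ [])) h            ≡⟨ ∑-++ (countFrom 0 (suc q)) _ h ⟩
  ∑ (countFrom 0 (suc q)) h + (f (suc q) * delay g (q ℕ.∸ q) + 0ℚ)
    ≡⟨ cong (λ z → ∑ (countFrom 0 (suc q)) h + (f (suc q) * delay g z + 0ℚ)) (ℕP.n∸n≡0 q) ⟩
  ∑ (countFrom 0 (suc q)) h + (f (suc q) * 0ℚ + 0ℚ)
    ≡⟨ cong (λ z → ∑ (countFrom 0 (suc q)) h + (z + 0ℚ)) (ℚP.*-zeroʳ (f (suc q))) ⟩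
  ∑ (countFrom 0 (suc q)) h + 0ℚ                      ≡⟨ ℚP.+-identityʳ _ ⟩
  ∑ (countFrom 0 (suc q)) h
    ≡⟨ ∑-congᴬ (All.map (λ {s} s<1+q → cong (λ z → f s * delay g z) (ℕP.+-∸-assoc 1 (ℕP.≤-pred s<1+q)))
                        (countFrom-bounded 0 (suc q))) ⟩
  ∑ (countFrom 0 (suc q)) (λ s → f s * g (q ℕ.∸ s))
    ≡⟨ cong (λ ns → ∑ ns (λ s → f s * g (q ℕ.∸ s))) (range≡countFrom 0 q) ⟨
  ∑ (range 0 q) (λ s → f s * g (q ℕ.∸ s))             ∎
  where
  open ≡-Reasoning
  h : ℕ → ℚ
  h s = f s * delay g (suc q ℕ.∸ s)

-- Multiplying by the first (or last) factor of the denominator lowers its exponent: where that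
-- exponent was 1 the factor disappears (the m-part term), otherwise the weight drops to q − 1
-- (the delayed term, which is 0 when q = 0).
etaTerm-firstFactor : ∀ m q x →
  fromℕ (suc x) * etaTerm (suc m) q (suc x) ≡ etaTerm m q (suc (suc x)) + delay (λ k → etaTerm (suc m) k (suc x)) q
etaTerm-firstFactor m zero x rewrite etaTerm-zero (suc m) (suc x) | etaTerm-zero m (suc (suc x)) =
  trans (fromℕ*inv-cancelˡ x (rising (suc (suc x)) m)) (sym (ℚP.+-identityʳ _))
etaTerm-firstFactor m (suc q) x = begin
  fromℕ y * etaTerm (suc m) (suc q) y
    ≡⟨ cong (fromℕ y *_) (etaTerm-suc m (suc q) y) ⟩
  fromℕ y * ∑ (range 0 (suc q)) term
    ≡⟨ cong (λ ns → fromℕ y * ∑ ns term) (range0-suc q) ⟩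
  fromℕ y * (term 0 + ∑ (map suc (range 0 q)) term)
    ≡⟨ cong (λ z → fromℕ y * (term 0 + z)) (∑-map (range 0 q) suc term) ⟩
  fromℕ y * (term 0 + ∑ (range 0 q) (term ∘ suc))
    ≡⟨ ℚP.*-distribˡ-+ (fromℕ y) (term 0) (∑ (range 0 q) (term ∘ suc)) ⟩
  fromℕ y * term 0 + fromℕ y * ∑ (range 0 q) (term ∘ suc)
    ≡⟨ cong₂ _+_ (trans (cancel 0 (suc q)) (ℚP.*-identityˡ (etaTerm m (suc q) (suc y))))
                 (sym (∑-distribˡ-* (range 0 q) (fromℕ y) (term ∘ suc))) ⟩
  etaTerm m (suc q) (suc y) + ∑ (range 0 q) (λ s → fromℕ y * term (suc s))
    ≡⟨ cong (λ z → etaTerm m (suc q) (suc y) + z) (∑-cong (range 0 q) (λ s → cancel (suc s) (q ℕ.∸ s))) ⟩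
  etaTerm m (suc q) (suc y) + ∑ (range 0 q) (λ s → inv (y ℕ.^ suc s) * etaTerm m (q ℕ.∸ s) (suc y))
    ≡⟨ cong (λ z → etaTerm m (suc q) (suc y) + z) (etaTerm-suc m q y) ⟨
  etaTerm m (suc q) (suc y) + etaTerm (suc m) q y ∎
  where
  open ≡-Reasoning
  y = suc x
  term : ℕ → ℚ
  term s = inv (y ℕ.^ suc s) * etaTerm m (suc q ℕ.∸ s) (suc y)
  cancel : ∀ s k → fromℕ y * (inv (y ℕ.^ suc s) * etaTerm m k (suc y)) ≡ inv (y ℕ.^ s) * etaTerm m k (suc y)
  cancel s k = trans (sym (ℚP.*-assoc (fromℕ y) (inv (y ℕ.^ suc s)) (etaTerm m k (suc y))))
                     (cong (_* etaTerm m k (suc y)) (fromℕ*inv-cancelˡ x (y ℕ.^ s)))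

etaTerm-lastFactor : ∀ m q x →
  fromℕ (suc x ℕ.+ m) * etaTerm (suc m) q (suc x) ≡ etaTerm m q (suc x) + delay (λ k → etaTerm (suc m) k (suc x)) q
etaTerm-lastFactor m zero x
  rewrite etaTerm-zero (suc m) (suc x) | etaTerm-zero m (suc x) | rising-suc-last (suc x) m
        | ℕP.*-comm (rising (suc x) m) (suc x ℕ.+ m) =
  trans (fromℕ*inv-cancelˡ (x ℕ.+ m) (rising (suc x) m)) (sym (ℚP.+-identityʳ _))
etaTerm-lastFactor zero (suc q) x rewrite ℕP.+-identityʳ x | etaTerm-one (suc q) (suc x) | etaTerm-one q (suc x) =
  trans (fromℕ*inv-cancelˡ x (suc x ℕ.^ suc q)) (sym (ℚP.+-identityˡ _))
etaTerm-lastFactor (suc m) (suc q) x = begin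
  fromℕ (y ℕ.+ suc m) * etaTerm (suc (suc m)) (suc q) y
    ≡⟨ cong₂ _*_ (cong fromℕ (ℕP.+-suc y m)) (etaTerm-suc (suc m) (suc q) y) ⟩
  c * ∑ ss (λ s → f s * shifted (q′ s))
    ≡⟨ ∑-distribˡ-* ss c (λ s → f s * shifted (q′ s)) ⟨
  ∑ ss (λ s → c * (f s * shifted (q′ s)))
    ≡⟨ ∑-cong ss (λ s → expand s (q′ s)) ⟩
  ∑ ss (λ s → f s * etaTerm m (q′ s) (suc y) + f s * delay shifted (q′ s))
    ≡⟨ ∑-distrib-+ ss (λ s → f s * etaTerm m (q′ s) (suc y)) (λ s → f s * delay shifted (q′ s)) ⟩
  ∑ ss (λ s → f s * etaTerm m (q′ s) (suc y)) + ∑ ss (λ s → f s * delay shifted (q′ s))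
    ≡⟨ cong₂ _+_ (sym (etaTerm-suc m (suc q) y))
                 (trans (∑-convolution-delay q f shifted) (sym (etaTerm-suc (suc m) q y))) ⟩
  etaTerm (suc m) (suc q) y + etaTerm (suc (suc m)) q y ∎
  where
  open ≡-Reasoning
  y = suc x
  c = fromℕ (suc y ℕ.+ m)
  ss = range 0 (suc q)
  q′ : ℕ → ℕ
  q′ s = suc q ℕ.∸ s
  f : ℕ → ℚ
  f s = inv (y ℕ.^ suc s)
  shifted : ℕ → ℚ
  shifted k = etaTerm (suc m) k (suc y)
  expand : ∀ s k → c * (f s * shifted k) ≡ f s * etaTerm m k (suc y) + f s * delay shifted k
  expand s k = begin
    c * (f s * shifted k)
      ≡⟨ solve 3 (λ a b e → a :* (b :* e) := b :* (a :* e)) refl c (f s) (shifted k) ⟩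
    f s * (c * shifted k)
      ≡⟨ cong (f s *_) (etaTerm-lastFactor m k (suc x)) ⟩
    f s * (etaTerm m k (suc y) + delay shifted k)
      ≡⟨ ℚP.*-distribˡ-+ (f s) (etaTerm m k (suc y)) (delay shifted k) ⟩
    f s * etaTerm m k (suc y) + f s * delay shifted k ∎
    where open ℚ-Solver

etaTerm-difference : ∀ m q x → fromℕ m * etaTerm (suc m) q (suc x) ≡ etaTerm m q (suc x) - etaTerm m q (suc (suc x))
etaTerm-difference m q x = begin
  fromℕ m * e
    ≡⟨ solve 3 (λ a b c → a :* c := (b :+ a) :* c :- b :* c) refl (fromℕ m) (fromℕ (suc x)) e ⟩
  (fromℕ (suc x) + fromℕ m) * e - fromℕ (suc x) * e
    ≡⟨ cong (λ z → z * e - fromℕ (suc x) * e) (fromℕ-+ (suc x) m) ⟨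
  fromℕ (suc x ℕ.+ m) * e - fromℕ (suc x) * e
    ≡⟨ cong₂ _-_ (etaTerm-lastFactor m q x) (etaTerm-firstFactor m q x) ⟩
  (a + d) - (b + d)
    ≡⟨ solve 3 (λ a b d → (a :+ d) :- (b :+ d) := a :- b) refl a b d ⟩
  a - b ∎
  where
  open ≡-Reasoning; open ℚ-Solver
  a = etaTerm m q (suc x)
  b = etaTerm m q (suc (suc x))
  e = etaTerm (suc m) q (suc x)
  d = delay (λ k → etaTerm (suc m) k (suc x)) q

lhsPartial-closedForm : ∀ r q N → lhsPartial r q N ≡ inv (suc r) * (etaTerm (suc r) q 1 - etaTerm (suc r) q (suc N))
lhsPartial-closedForm r q N = begin
  lhsPartial r q N
    ≡⟨ ∑-comm (comps (suc (suc r)) q) (range 1 N) (λ s n → inv (etaDen n (map suc s))) ⟩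
  ∑ (range 1 N) (etaTerm (suc (suc r)) q)
    ≡⟨ cong (λ ns → ∑ ns (etaTerm (suc (suc r)) q)) (trans (range≡countFrom 1 N) (countFrom-suc 0 N)) ⟩
  ∑ (map suc (countFrom 0 N)) (etaTerm (suc (suc r)) q)
    ≡⟨ ∑-map (countFrom 0 N) suc (etaTerm (suc (suc r)) q) ⟩
  ∑ (countFrom 0 N) (λ n → etaTerm (suc (suc r)) q (suc n))
    ≡⟨ ∑-cong (countFrom 0 N) (λ n → fromℕ*a≡b⇒a≡inv*b r _ _ (etaTerm-difference (suc r) q n)) ⟩
  ∑ (countFrom 0 N) (λ n → inv (suc r) * (g n - g (suc n)))
    ≡⟨ ∑-distribˡ-* (countFrom 0 N) (inv (suc r)) (λ n → g n - g (suc n)) ⟩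
  inv (suc r) * ∑ (countFrom 0 N) (λ n → g n - g (suc n))
    ≡⟨ cong (inv (suc r) *_) (∑-telescoping g 0 N) ⟩
  inv (suc r) * (etaTerm (suc r) q 1 - etaTerm (suc r) q (suc N)) ∎
  where
  open ≡-Reasoning
  g : ℕ → ℚ
  g n = etaTerm (suc r) q (suc n)

All-comps-suc : ∀ {P : List ℕ → Set} → (∀ b bs → P (b ∷ bs)) → ∀ m q → All P (comps (suc m) q)
All-comps-suc {P} P-cons m q = go (range 0 q)
  where
  go : ∀ ss → All P (concatMap (λ s → map (s ∷_) (comps m (q ℕ.∸ s))) ss)
  go []       = []
  go (s ∷ ss) = All.++⁺ (All.map⁺ (All.universal (P-cons s) (comps m (q ℕ.∸ s)))) (go ss)

etaTerm-bound : ∀ m q x → etaTerm (suc m) q (suc x) ≤ fromℕ (length (comps (suc m) q)) * inv (suc x)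
etaTerm-bound m q x = ∑≤length* (comps (suc m) q) (inv (suc x)) (All-comps-suc term≤ m q)
  where
  term≤ : ∀ b bs → inv (etaDen (suc x) (map suc (b ∷ bs))) ≤ inv (suc x)
  term≤ b bs = ℚP.≤-trans
    (ℚP.≤-reflexive (cong inv (ℕP.*-assoc (suc x) (suc x ℕ.^ b) (etaDen (suc (suc x)) (map suc bs)))))
    (inv-*≤ x (suc x ℕ.^ b ℕ.* etaDen (suc (suc x)) (map suc bs)))

rhoSum : ℕ → ℕ → ℕ → ℕ → ℕ → ℚ
rhoSum r q off lb N = ∑ (comps (suc q) r) (λ α → rhoAux (incLast α) off lb N)

rhoFactor : ℕ → ℕ → ℕ → ℚ
rhoFactor off s n = inv (rising (n ℕ.+ off) (suc s))

rhoFactor-nonNeg : ∀ off s n → 0ℚ ≤ rhoFactor off s n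
rhoFactor-nonNeg off s n = inv-nonNeg (rising (n ℕ.+ off) (suc s))

rhoAux-nonNeg : ∀ as off lb N → 0ℚ ≤ rhoAux as off lb N
rhoAux-nonNeg []       off lb N = ℚ.*≤* (ℤ.+≤+ z≤n)
rhoAux-nonNeg (a ∷ as) off lb N =
  ∑-nonNeg (range lb N) (λ n → *-0≤ (rhoFactor-nonNeg off a n) (rhoAux-nonNeg as (off ℕ.+ a) (suc n) N))

rhoSum-nonNeg : ∀ r q off lb N → 0ℚ ≤ rhoSum r q off lb N
rhoSum-nonNeg r q off lb N = ∑-nonNeg (comps (suc q) r) (λ α → rhoAux-nonNeg (incLast α) off lb N)

rhoSum-zero : ∀ r off lb N → rhoSum r 0 off lb N ≡ ∑ (range lb N) (rhoFactor off (suc r))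
rhoSum-zero r off lb N rewrite comps-one r =
  trans (ℚP.+-identityʳ (rhoAux (suc r ∷ []) off lb N))
        (∑-cong (range lb N) (λ n → ℚP.*-identityʳ (rhoFactor off (suc r) n)))

rhoSum-suc : ∀ r q off lb N → rhoSum r (suc q) off lb N ≡
  ∑ (range 0 r) (λ s → ∑ (range lb N) (λ n → rhoFactor off s n * rhoSum (r ℕ.∸ s) q (off ℕ.+ s) (suc n) N))
rhoSum-suc r q off lb N = begin
  rhoSum r (suc q) off lb N
    ≡⟨ ∑-concatMap (range 0 r) (λ s → map (s ∷_) (tails s)) term ⟩
  ∑ (range 0 r) (λ s → ∑ (map (s ∷_) (tails s)) term)
    ≡⟨ ∑-cong (range 0 r) (λ s → ∑-map (tails s) (s ∷_) term) ⟩
  ∑ (range 0 r) (λ s → ∑ (tails s) (λ α → rhoAux (incLast (s ∷ α)) off lb N))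
    ≡⟨ ∑-cong (range 0 r) (λ s → ∑-congᴬ (All-comps-suc (λ _ _ → refl) q (r ℕ.∸ s))) ⟩
  ∑ (range 0 r) (λ s → ∑ (tails s) (λ α → ∑ ns (λ n → rhoFactor off s n * inner s n α)))
    ≡⟨ ∑-cong (range 0 r) (λ s → ∑-comm (tails s) ns (λ α n → rhoFactor off s n * inner s n α)) ⟩
  ∑ (range 0 r) (λ s → ∑ ns (λ n → ∑ (tails s) (λ α → rhoFactor off s n * inner s n α)))
    ≡⟨ ∑-cong (range 0 r) (λ s → ∑-cong ns (λ n → ∑-distribˡ-* (tails s) (rhoFactor off s n) (inner s n))) ⟩
  ∑ (range 0 r) (λ s → ∑ ns (λ n → rhoFactor off s n * rhoSum (r ℕ.∸ s) q (off ℕ.+ s) (suc n) N)) ∎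
  where
  open ≡-Reasoning
  ns = range lb N
  tails : ℕ → List (List ℕ)
  tails s = comps (suc q) (r ℕ.∸ s)
  term : List ℕ → ℚ
  term α = rhoAux (incLast α) off lb N
  inner : ℕ → ℕ → List ℕ → ℚ
  inner s n α = rhoAux (incLast α) (off ℕ.+ s) (suc n) N

rhoFactor-telescoping : ∀ off r n →
  rhoFactor off (suc r) (suc n) ≡ inv (suc r) * (rhoFactor off r (suc n) - rhoFactor off r (suc (suc n)))
rhoFactor-telescoping off r n = fromℕ*a≡b⇒a≡inv*b r _ _ (begin
  fromℕ (suc r) * inv (rising (suc y) (suc (suc r)))   ≡⟨ cong (fromℕ (suc r) *_) (etaTerm-zero (suc (suc r)) (suc y)) ⟨
  fromℕ (suc r) * etaTerm (suc (suc r)) 0 (suc y)      ≡⟨ etaTerm-difference (suc r) 0 y ⟩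
  etaTerm (suc r) 0 (suc y) - etaTerm (suc r) 0 (suc (suc y))
    ≡⟨ cong₂ _-_ (etaTerm-zero (suc r) (suc y)) (etaTerm-zero (suc r) (suc (suc y))) ⟩
  inv (rising (suc y) (suc r)) - inv (rising (suc (suc y)) (suc r)) ∎)
  where
  open ≡-Reasoning
  y = n ℕ.+ off

∑-rhoFactor-closedForm : ∀ off r l N →
  ∑ (range (suc l) N) (rhoFactor off (suc r)) ≡ inv (suc r) * (rhoFactor off r (suc l) - rhoFactor off r (suc (l ℕ.+ (N ℕ.∸ l))))
∑-rhoFactor-closedForm off r l N = begin
  ∑ (range (suc l) N) (rhoFactor off (suc r))
    ≡⟨ cong (λ ns → ∑ ns (rhoFactor off (suc r))) (trans (range≡countFrom (suc l) N) (countFrom-suc l (N ℕ.∸ l))) ⟩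
  ∑ (map suc (countFrom l (N ℕ.∸ l))) (rhoFactor off (suc r))
    ≡⟨ ∑-map (countFrom l (N ℕ.∸ l)) suc (rhoFactor off (suc r)) ⟩
  ∑ (countFrom l (N ℕ.∸ l)) (λ n → rhoFactor off (suc r) (suc n))
    ≡⟨ ∑-cong (countFrom l (N ℕ.∸ l)) (rhoFactor-telescoping off r) ⟩
  ∑ (countFrom l (N ℕ.∸ l)) (λ n → inv (suc r) * (f n - f (suc n)))
    ≡⟨ ∑-distribˡ-* (countFrom l (N ℕ.∸ l)) (inv (suc r)) (λ n → f n - f (suc n)) ⟩
  inv (suc r) * ∑ (countFrom l (N ℕ.∸ l)) (λ n → f n - f (suc n))
    ≡⟨ cong (inv (suc r) *_) (∑-telescoping f l (N ℕ.∸ l)) ⟩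
  inv (suc r) * (f l - f (l ℕ.+ (N ℕ.∸ l))) ∎
  where
  open ≡-Reasoning
  f : ℕ → ℚ
  f n = rhoFactor off r (suc n)

∑-rhoFactor≤ : ∀ off r l N → ∑ (range (suc l) N) (rhoFactor off (suc r)) ≤ inv (suc r) * rhoFactor off r (suc l)
∑-rhoFactor≤ off r l N = begin
  ∑ (range (suc l) N) (rhoFactor off (suc r))        ≡⟨ ∑-rhoFactor-closedForm off r l N ⟩
  inv (suc r) * (rhoFactor off r (suc l) - rhoFactor off r (suc j))
    ≤⟨ *-monoˡ-≤-0≤ (inv (suc r)) (inv-nonNeg (suc r)) (a-b≤a _ (rhoFactor-nonNeg off r (suc j))) ⟩
  inv (suc r) * rhoFactor off r (suc l)              ∎
  where
  open ℚP.≤-Reasoning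
  j = l ℕ.+ (N ℕ.∸ l)

≤∑-rhoFactor+inv : ∀ off r l N →
  inv (suc r) * rhoFactor off r (suc l) ≤ ∑ (range (suc l) N) (rhoFactor off (suc r)) + inv (suc N)
≤∑-rhoFactor+inv off r l N = begin
  inv (suc r) * rhoFactor off r (suc l)
    ≡⟨ solve 3 (λ i a b → i :* a := i :* (a :- b) :+ i :* b) refl (inv (suc r)) (rhoFactor off r (suc l)) last ⟩
  inv (suc r) * (rhoFactor off r (suc l) - last) + inv (suc r) * last
    ≡⟨ cong (_+ inv (suc r) * last) (∑-rhoFactor-closedForm off r l N) ⟨
  ∑ (range (suc l) N) (rhoFactor off (suc r)) + inv (suc r) * last
    ≤⟨ ℚP.+-monoʳ-≤ (∑ (range (suc l) N) (rhoFactor off (suc r))) last≤ ⟩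
  ∑ (range (suc l) N) (rhoFactor off (suc r)) + inv (suc N) ∎
  where
  open ℚP.≤-Reasoning; open ℚ-Solver
  j = l ℕ.+ (N ℕ.∸ l)
  last = rhoFactor off r (suc j)
  last≤ : inv (suc r) * last ≤ inv (suc N)
  last≤ = begin
    inv (suc r) * last              ≤⟨ *-monoʳ-≤-0≤ last (rhoFactor-nonNeg off r (suc j)) (inv≤1 (suc r)) ⟩
    1ℚ * last                       ≡⟨ ℚP.*-identityˡ last ⟩
    inv (suc (j ℕ.+ off) ℕ.* rising (suc (suc j ℕ.+ off)) r) ≤⟨ inv-*≤ (j ℕ.+ off) (rising (suc (suc j ℕ.+ off)) r) ⟩
    inv (suc (j ℕ.+ off))           ≤⟨ inv-antimono-≤ (ℕP.≤-trans (ℕP.m≤n+m∸n N l) (ℕP.m≤m+n j off)) ⟩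
    inv (suc N)                     ∎

rhoConst rhoConstSum : ℕ → ℕ → ℚ
rhoConst r zero    = inv (suc r)
rhoConst r (suc q) = inv (suc r) * rhoConstSum r q
rhoConstSum r q = ∑ (range 0 r) (λ s → rhoConst (r ℕ.∸ s) q)

rhoConst-nonNeg : ∀ r q → 0ℚ ≤ rhoConst r q
rhoConstSum-nonNeg : ∀ r q → 0ℚ ≤ rhoConstSum r q
rhoConst-nonNeg r zero    = inv-nonNeg (suc r)
rhoConst-nonNeg r (suc q) = *-0≤ (inv-nonNeg (suc r)) (rhoConstSum-nonNeg r q)
rhoConstSum-nonNeg r q = ∑-nonNeg (range 0 r) (λ s → rhoConst-nonNeg (r ℕ.∸ s) q)

-- The limit of rhoSum r q off (suc l) N as N → ∞ is rhoLimit r q (suc l + off).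
rhoLimit : ℕ → ℕ → ℕ → ℚ
rhoLimit r q y = rhoConst r q * inv (rising y (suc r))

rhoFactor*rhoLimit : ∀ r q s n off → s ℕ.≤ r →
  rhoFactor off s n * rhoLimit (r ℕ.∸ s) q (suc n ℕ.+ (off ℕ.+ s)) ≡ rhoConst (r ℕ.∸ s) q * rhoFactor off (suc r) n
rhoFactor*rhoLimit r q s n off s≤r = begin
  a * (c * inv (rising z k))                             ≡⟨ solve 3 (λ a c b → a :* (c :* b) := c :* (a :* b)) refl a c (inv (rising z k)) ⟩
  c * (a * inv (rising z k))                             ≡⟨ cong (c *_) (inv-* (rising y (suc s)) (rising z k)) ⟨
  c * inv (rising y (suc s) ℕ.* rising z k)              ≡⟨ cong (λ w → c * inv (rising y (suc s) ℕ.* rising w k)) shift ⟩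
  c * inv (rising y (suc s) ℕ.* rising (y ℕ.+ suc s) k)  ≡⟨ cong (λ w → c * inv w) (rising-+ y (suc s) k) ⟨
  c * inv (rising y (suc s ℕ.+ k))                       ≡⟨ cong (λ w → c * inv (rising y w)) length≡ ⟩
  c * inv (rising y (suc (suc r)))                       ∎
  where
  open ≡-Reasoning; open ℚ-Solver
  y = n ℕ.+ off
  z = suc n ℕ.+ (off ℕ.+ s)
  k = suc (r ℕ.∸ s)
  a = rhoFactor off s n
  c = rhoConst (r ℕ.∸ s) q
  shift : z ≡ y ℕ.+ suc s
  shift = trans (cong suc (sym (ℕP.+-assoc n off s))) (sym (ℕP.+-suc y s))
  length≡ : suc s ℕ.+ k ≡ suc (suc r)
  length≡ = cong suc (trans (ℕP.+-suc s (r ℕ.∸ s)) (cong suc (ℕP.m+[n∸m]≡n s≤r)))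

∑∑rhoFactor*rhoLimit : ∀ r q off lb K →
  ∑ (range 0 r) (λ s → ∑ (range lb K) (λ n → rhoFactor off s n * rhoLimit (r ℕ.∸ s) q (suc n ℕ.+ (off ℕ.+ s))))
  ≡ rhoConstSum r q * ∑ (range lb K) (rhoFactor off (suc r))
∑∑rhoFactor*rhoLimit r q off lb K = begin
  ∑ (range 0 r) (λ s → ∑ (range lb K) (λ n → rhoFactor off s n * rhoLimit (r ℕ.∸ s) q (suc n ℕ.+ (off ℕ.+ s))))
    ≡⟨ ∑-congᴬ (All.map (λ {s} s≤r → ∑-cong (range lb K) (λ n → rhoFactor*rhoLimit r q s n off s≤r))
                        (range0-bounded r)) ⟩
  ∑ (range 0 r) (λ s → ∑ (range lb K) (λ n → rhoConst (r ℕ.∸ s) q * rhoFactor off (suc r) n))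
    ≡⟨ ∑-cong (range 0 r) (λ s → ∑-distribˡ-* (range lb K) (rhoConst (r ℕ.∸ s) q) (rhoFactor off (suc r))) ⟩
  ∑ (range 0 r) (λ s → rhoConst (r ℕ.∸ s) q * ∑ (range lb K) (rhoFactor off (suc r)))
    ≡⟨ ∑-distribʳ-* (range 0 r) (∑ (range lb K) (rhoFactor off (suc r))) (λ s → rhoConst (r ℕ.∸ s) q) ⟩
  rhoConstSum r q * ∑ (range lb K) (rhoFactor off (suc r)) ∎
  where open ≡-Reasoning

rhoSum≤rhoLimit : ∀ q r off l N → rhoSum r q off (suc l) N ≤ rhoLimit r q (suc l ℕ.+ off)
rhoSum≤rhoLimit zero    r off l N = ℚP.≤-trans (ℚP.≤-reflexive (rhoSum-zero r off (suc l) N)) (∑-rhoFactor≤ off r l N)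
rhoSum≤rhoLimit (suc q) r off l N = begin
  rhoSum r (suc q) off (suc l) N
    ≡⟨ rhoSum-suc r q off (suc l) N ⟩
  ∑ (range 0 r) (λ s → ∑ (range (suc l) N) (λ n → rhoFactor off s n * rhoSum (r ℕ.∸ s) q (off ℕ.+ s) (suc n) N))
    ≤⟨ ∑-mono (range 0 r) (λ s → ∑-mono (range (suc l) N) (λ n →
         *-monoˡ-≤-0≤ (rhoFactor off s n) (rhoFactor-nonNeg off s n) (rhoSum≤rhoLimit q (r ℕ.∸ s) (off ℕ.+ s) n N))) ⟩
  ∑ (range 0 r) (λ s → ∑ (range (suc l) N) (λ n → rhoFactor off s n * rhoLimit (r ℕ.∸ s) q (suc n ℕ.+ (off ℕ.+ s))))
    ≡⟨ ∑∑rhoFactor*rhoLimit r q off (suc l) N ⟩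
  rhoConstSum r q * ∑ (range (suc l) N) (rhoFactor off (suc r))
    ≤⟨ *-monoˡ-≤-0≤ (rhoConstSum r q) (rhoConstSum-nonNeg r q) (∑-rhoFactor≤ off r l N) ⟩
  rhoConstSum r q * (inv (suc r) * rhoFactor off r (suc l))
    ≡⟨ solve 3 (λ a i t → a :* (i :* t) := (i :* a) :* t) refl (rhoConstSum r q) (inv (suc r)) (rhoFactor off r (suc l)) ⟩
  rhoLimit r (suc q) (suc l ℕ.+ off) ∎
  where
  open ℚP.≤-Reasoning; open ℚ-Solver

∑∑-*-distrib-+ : ∀ (ss ns : List ℕ) (a x : ℕ → ℕ → ℚ) e →
  ∑ ss (λ s → ∑ ns (λ n → a s n * (x s n + e)))
  ≡ ∑ ss (λ s → ∑ ns (λ n → a s n * x s n)) + e * ∑ ss (λ s → ∑ ns (a s))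
∑∑-*-distrib-+ ss ns a x e = begin
  ∑ ss (λ s → ∑ ns (λ n → a s n * (x s n + e)))
    ≡⟨ ∑-cong ss (λ s → ∑-cong ns (λ n → solve 3 (λ a x e → a :* (x :+ e) := a :* x :+ e :* a) refl (a s n) (x s n) e)) ⟩
  ∑ ss (λ s → ∑ ns (λ n → a s n * x s n + e * a s n))
    ≡⟨ ∑-cong ss (λ s → trans (∑-distrib-+ ns (λ n → a s n * x s n) (λ n → e * a s n))
                              (cong (λ z → ∑ ns (λ n → a s n * x s n) + z) (∑-distribˡ-* ns e (a s)))) ⟩
  ∑ ss (λ s → ∑ ns (λ n → a s n * x s n) + e * ∑ ns (a s))
    ≡⟨ ∑-distrib-+ ss (λ s → ∑ ns (λ n → a s n * x s n)) (λ s → e * ∑ ns (a s)) ⟩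
  ∑ ss (λ s → ∑ ns (λ n → a s n * x s n)) + ∑ ss (λ s → e * ∑ ns (a s))
    ≡⟨ cong (λ z → ∑ ss (λ s → ∑ ns (λ n → a s n * x s n)) + z) (∑-distribˡ-* ss e (λ s → ∑ ns (a s))) ⟩
  ∑ ss (λ s → ∑ ns (λ n → a s n * x s n)) + e * ∑ ss (λ s → ∑ ns (a s)) ∎
  where open ≡-Reasoning; open ℚ-Solver

rhoLimit≤truncation : ∀ r q off l K →
  rhoLimit r (suc q) (suc l ℕ.+ off)
    ≤ ∑ (range 0 r) (λ s → ∑ (range (suc l) K) (λ n → rhoFactor off s n * rhoLimit (r ℕ.∸ s) q (suc n ℕ.+ (off ℕ.+ s))))
      + rhoConstSum r q * inv (suc K)
rhoLimit≤truncation r q off l K = begin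
  rhoLimit r (suc q) (suc l ℕ.+ off)
    ≡⟨ solve 3 (λ i a t → (i :* a) :* t := a :* (i :* t)) refl (inv (suc r)) C (rhoFactor off r (suc l)) ⟩
  C * (inv (suc r) * rhoFactor off r (suc l))
    ≤⟨ *-monoˡ-≤-0≤ C (rhoConstSum-nonNeg r q) (≤∑-rhoFactor+inv off r l K) ⟩
  C * (∑ (range (suc l) K) (rhoFactor off (suc r)) + inv (suc K))
    ≡⟨ ℚP.*-distribˡ-+ C (∑ (range (suc l) K) (rhoFactor off (suc r))) (inv (suc K)) ⟩
  C * ∑ (range (suc l) K) (rhoFactor off (suc r)) + C * inv (suc K)
    ≡⟨ cong (_+ C * inv (suc K)) (∑∑rhoFactor*rhoLimit r q off (suc l) K) ⟨
  ∑ (range 0 r) (λ s → ∑ (range (suc l) K) (λ n → rhoFactor off s n * rhoLimit (r ℕ.∸ s) q (suc n ℕ.+ (off ℕ.+ s))))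
    + C * inv (suc K) ∎
  where
  open ℚP.≤-Reasoning; open ℚ-Solver
  C = rhoConstSum r q

rhoSum-suc-truncated≤ : ∀ r q off l {K N} → K ℕ.≤ N →
  ∑ (range 0 r) (λ s → ∑ (range (suc l) K) (λ n → rhoFactor off s n * rhoSum (r ℕ.∸ s) q (off ℕ.+ s) (suc n) N))
  ≤ rhoSum r (suc q) off (suc l) N
rhoSum-suc-truncated≤ r q off l {K} {N} K≤N = ℚP.≤-trans
  (∑-mono (range 0 r) (λ s → ∑-range-monoʳ (term s) (λ n → *-0≤ (rhoFactor-nonNeg off s n) (inner-nonNeg s n)) (suc l) K≤N))
  (ℚP.≤-reflexive (sym (rhoSum-suc r q off (suc l) N)))
  where
  term : ℕ → ℕ → ℚ
  term s n = rhoFactor off s n * rhoSum (r ℕ.∸ s) q (off ℕ.+ s) (suc n) N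
  inner-nonNeg : ∀ s n → 0ℚ ≤ rhoSum (r ℕ.∸ s) q (off ℕ.+ s) (suc n) N
  inner-nonNeg s n = rhoSum-nonNeg (r ℕ.∸ s) q (off ℕ.+ s) (suc n) N

-- For q + 1, half of ε covers the outer indices n₁ > K (the tail of the limit is small), the
-- other half the finitely many inner sums with n₁ ≤ K, each within η of its limit by induction.
rhoLimit≤rhoSum+ε : ∀ q r off l ε → 0ℚ < ε →
  Eventually (λ N → rhoLimit r q (suc l ℕ.+ off) ≤ rhoSum r q off (suc l) N + ε)
rhoLimit≤rhoSum+ε zero r off l ε 0<ε with eventually-inv≤ ε 0<ε
... | N₀ , inv≤ε = N₀ , λ N N₀≤N → begin
  rhoLimit r 0 (suc l ℕ.+ off)         ≤⟨ ≤∑-rhoFactor+inv off r l N ⟩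
  tail N + inv (suc N)                 ≤⟨ ℚP.+-monoʳ-≤ (tail N) (inv≤ε N N₀≤N) ⟩
  tail N + ε                           ≡⟨ cong (_+ ε) (rhoSum-zero r off (suc l) N) ⟨
  rhoSum r 0 off (suc l) N + ε         ∎
  where
  open ℚP.≤-Reasoning
  tail : ℕ → ℚ
  tail N = ∑ (range (suc l) N) (rhoFactor off (suc r))
rhoLimit≤rhoSum+ε (suc q) r off l ε 0<ε =
  K ℕ.⊔ N₁ , λ N K⊔N₁≤N →
    bound N (ℕP.≤-trans (ℕP.m≤m⊔n K N₁) K⊔N₁≤N) (close N (ℕP.≤-trans (ℕP.m≤n⊔m K N₁) K⊔N₁≤N))
  where
  open ℚP.≤-Reasoning
  ss = range 0 r
  a = rhoFactor off
  inner : ℕ → ℕ → ℕ → ℚ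
  inner N s n = rhoSum (r ℕ.∸ s) q (off ℕ.+ s) (suc n) N
  limit : ℕ → ℕ → ℚ
  limit s n = rhoLimit (r ℕ.∸ s) q (suc n ℕ.+ (off ℕ.+ s))
  truncation = eventually-*inv≤ (rhoConstSum r q) (half ε) (half-pos 0<ε)
  K = proj₁ truncation
  ns = range (suc l) K
  multiplier = small-multiplier (∑ ss (λ s → ∑ ns (a s))) (half ε) (half-pos 0<ε)
  η = proj₁ multiplier
  approximations = eventually-All (λ s N → All (λ n → limit s n ≤ inner N s n + η) ns) ss
    (λ s → eventually-All (λ n N → limit s n ≤ inner N s n + η) ns
      (λ n → rhoLimit≤rhoSum+ε q (r ℕ.∸ s) (off ℕ.+ s) n η (proj₁ (proj₂ multiplier))))
  N₁ = proj₁ approximations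
  close = proj₂ approximations
  bound : ∀ N → K ℕ.≤ N → All (λ s → All (λ n → limit s n ≤ inner N s n + η) ns) ss →
    rhoLimit r (suc q) (suc l ℕ.+ off) ≤ rhoSum r (suc q) off (suc l) N + ε
  bound N K≤N approx = begin
    rhoLimit r (suc q) (suc l ℕ.+ off)
      ≤⟨ rhoLimit≤truncation r q off l K ⟩
    ∑ ss (λ s → ∑ ns (λ n → a s n * limit s n)) + rhoConstSum r q * inv (suc K)
      ≤⟨ ℚP.+-mono-≤ (∑-monoᴬ (All.map (λ {s} → ∑-monoᴬ ∘ All.map (λ {n} → scale s n)) approx))
                     (proj₂ truncation K ℕP.≤-refl) ⟩
    ∑ ss (λ s → ∑ ns (λ n → a s n * (inner N s n + η))) + half ε
      ≡⟨ cong (_+ half ε) (∑∑-*-distrib-+ ss ns a (inner N) η) ⟩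
    (∑ ss (λ s → ∑ ns (λ n → a s n * inner N s n)) + η * ∑ ss (λ s → ∑ ns (a s))) + half ε
      ≤⟨ ℚP.+-monoˡ-≤ (half ε) (ℚP.+-mono-≤ (rhoSum-suc-truncated≤ r q off l K≤N) (proj₂ (proj₂ multiplier))) ⟩
    (S + half ε) + half ε
      ≡⟨ ℚP.+-assoc S (half ε) (half ε) ⟩
    S + (half ε + half ε)
      ≡⟨ cong (λ z → S + z) (half+half ε) ⟩
    S + ε ∎
    where
    S = rhoSum r (suc q) off (suc l) N
    scale : ∀ s n → limit s n ≤ inner N s n + η → a s n * limit s n ≤ a s n * (inner N s n + η)
    scale s n = *-monoˡ-≤-0≤ (a s n) (rhoFactor-nonNeg off s n)

commonLimit : ℕ → ℕ → ℚ
commonLimit r q = inv (suc r) * etaTerm (suc r) q 1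

∑-factorial*etaTerm : ∀ q r →
  ∑ (range 0 r) (λ s → fromℕ (rising 1 (r ℕ.∸ s)) * etaTerm (suc (r ℕ.∸ s)) q 1)
  ≡ fromℕ (rising 1 (suc r)) * etaTerm (suc r) (suc q) 1
∑-factorial*etaTerm q zero rewrite etaTerm-one q 1 | etaTerm-one (suc q) 1 | ℕP.^-zeroˡ (suc q) = refl
∑-factorial*etaTerm q (suc r) = begin
  ∑ (range 0 (suc r)) term
    ≡⟨ cong (λ ss → ∑ ss term) (range0-suc r) ⟩
  term 0 + ∑ (map suc (range 0 r)) term
    ≡⟨ cong (λ z → term 0 + z) (trans (∑-map (range 0 r) suc term) (∑-factorial*etaTerm q r)) ⟩
  f * etaTerm (suc (suc r)) q 1 + f * etaTerm (suc r) (suc q) 1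
    ≡⟨ ℚP.*-distribˡ-+ f (etaTerm (suc (suc r)) q 1) (etaTerm (suc r) (suc q) 1) ⟨
  f * (etaTerm (suc (suc r)) q 1 + etaTerm (suc r) (suc q) 1)
    ≡⟨ cong (f *_) (trans (ℚP.+-comm (etaTerm (suc (suc r)) q 1) (etaTerm (suc r) (suc q) 1))
                          (sym (etaTerm-lastFactor (suc r) (suc q) 0))) ⟩
  f * (fromℕ (1 ℕ.+ suc r) * etaTerm (suc (suc r)) (suc q) 1)
    ≡⟨ ℚP.*-assoc f (fromℕ (1 ℕ.+ suc r)) (etaTerm (suc (suc r)) (suc q) 1) ⟨
  (f * fromℕ (1 ℕ.+ suc r)) * etaTerm (suc (suc r)) (suc q) 1
    ≡⟨ cong (_* etaTerm (suc (suc r)) (suc q) 1) (trans (sym (fromℕ-* (rising 1 (suc r)) (1 ℕ.+ suc r)))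
                                                         (cong fromℕ (sym (rising-suc-last 1 (suc r))))) ⟩
  fromℕ (rising 1 (suc (suc r))) * etaTerm (suc (suc r)) (suc q) 1 ∎
  where
  open ≡-Reasoning
  f = fromℕ (rising 1 (suc r))
  term : ℕ → ℚ
  term s = fromℕ (rising 1 (suc r ℕ.∸ s)) * etaTerm (suc (suc r ℕ.∸ s)) q 1

rhoConst-closedForm : ∀ q r → rhoConst r q ≡ fromℕ (rising 1 r) * etaTerm (suc r) q 1
rhoConst-closedForm zero r with rising-positive 0 r
... | k , r!≡1+k rewrite etaTerm-zero (suc r) 1 | rising-suc-last 1 r | r!≡1+k = sym (fromℕ*inv-cancelˡ k (suc r))
rhoConst-closedForm (suc q) r = begin
  inv (suc r) * rhoConstSum r q
    ≡⟨ cong (inv (suc r) *_) (trans (∑-cong (range 0 r) (λ s → rhoConst-closedForm q (r ℕ.∸ s)))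
                                     (∑-factorial*etaTerm q r)) ⟩
  inv (suc r) * (fromℕ (rising 1 (suc r)) * e)
    ≡⟨ cong (λ z → inv (suc r) * (fromℕ z * e)) (trans (rising-suc-last 1 r) (ℕP.*-comm (rising 1 r) (suc r))) ⟩
  inv (suc r) * (fromℕ (suc r ℕ.* rising 1 r) * e)
    ≡⟨ cong (λ z → inv (suc r) * (z * e)) (fromℕ-* (suc r) (rising 1 r)) ⟩
  inv (suc r) * ((fromℕ (suc r) * fromℕ (rising 1 r)) * e)
    ≡⟨ solve 4 (λ i a b p → i :* ((a :* b) :* p) := (i :* a) :* (b :* p)) refl
               (inv (suc r)) (fromℕ (suc r)) (fromℕ (rising 1 r)) e ⟩
  (inv (suc r) * fromℕ (suc r)) * (fromℕ (rising 1 r) * e)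
    ≡⟨ cong (_* (fromℕ (rising 1 r) * e)) (inv-inverseˡ r) ⟩
  1ℚ * (fromℕ (rising 1 r) * e)
    ≡⟨ ℚP.*-identityˡ (fromℕ (rising 1 r) * e) ⟩
  fromℕ (rising 1 r) * e ∎
  where
  open ≡-Reasoning; open ℚ-Solver
  e = etaTerm (suc r) (suc q) 1

rhoLimit-one : ∀ r q → rhoLimit r q 1 ≡ commonLimit r q
rhoLimit-one r q with rising-positive 0 r
... | k , r!≡1+k = begin
  rhoConst r q * inv (rising 1 (suc r))
    ≡⟨ cong₂ (λ a b → a * inv b) (rhoConst-closedForm q r) (trans (rising-suc-last 1 r) (ℕP.*-comm (rising 1 r) (suc r))) ⟩
  (fromℕ (rising 1 r) * e) * inv (suc r ℕ.* rising 1 r)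
    ≡⟨ cong (λ z → (fromℕ z * e) * inv (suc r ℕ.* z)) r!≡1+k ⟩
  (fromℕ (suc k) * e) * inv (suc r ℕ.* suc k)
    ≡⟨ cong (λ z → (fromℕ (suc k) * e) * inv z) (ℕP.*-comm (suc r) (suc k)) ⟩
  (fromℕ (suc k) * e) * inv (suc k ℕ.* suc r)
    ≡⟨ solve 3 (λ a p b → (a :* p) :* b := p :* (a :* b)) refl (fromℕ (suc k)) e (inv (suc k ℕ.* suc r)) ⟩
  e * (fromℕ (suc k) * inv (suc k ℕ.* suc r))
    ≡⟨ cong (e *_) (fromℕ*inv-cancelˡ k (suc r)) ⟩
  e * inv (suc r)
    ≡⟨ ℚP.*-comm e (inv (suc r)) ⟩
  commonLimit r q ∎
  where
  open ≡-Reasoning; open ℚ-Solver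
  e = etaTerm (suc r) q 1

commonLimit≤lhsPartial+etaTerm : ∀ r q M → commonLimit r q ≤ lhsPartial r q M + etaTerm (suc r) q (suc M)
commonLimit≤lhsPartial+etaTerm r q M = begin
  commonLimit r q
    ≡⟨ solve 3 (λ i a b → i :* a := i :* (a :- b) :+ i :* b) refl (inv (suc r)) (etaTerm (suc r) q 1) tail ⟩
  inv (suc r) * (etaTerm (suc r) q 1 - tail) + inv (suc r) * tail
    ≡⟨ cong (_+ inv (suc r) * tail) (lhsPartial-closedForm r q M) ⟨
  lhsPartial r q M + inv (suc r) * tail
    ≤⟨ ℚP.+-monoʳ-≤ (lhsPartial r q M) (*-monoʳ-≤-0≤ tail (etaTerm-nonNeg (suc r) q (suc M)) (inv≤1 (suc r))) ⟩
  lhsPartial r q M + 1ℚ * tail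
    ≡⟨ cong (λ z → lhsPartial r q M + z) (ℚP.*-identityˡ tail) ⟩
  lhsPartial r q M + tail ∎
  where
  open ℚP.≤-Reasoning; open ℚ-Solver
  tail = etaTerm (suc r) q (suc M)

lhsPartial-supremum : ∀ r q → IsSupremum (lhsPartial r q) (commonLimit r q)
lhsPartial-supremum r q = record { upperBound = upperBound ; approximable = approximable }
  where
  upperBound : ∀ N → lhsPartial r q N ≤ commonLimit r q
  upperBound N = begin
    lhsPartial r q N                                              ≡⟨ lhsPartial-closedForm r q N ⟩
    inv (suc r) * (etaTerm (suc r) q 1 - etaTerm (suc r) q (suc N))
      ≤⟨ *-monoˡ-≤-0≤ (inv (suc r)) (inv-nonNeg (suc r)) (a-b≤a (etaTerm (suc r) q 1) (etaTerm-nonNeg (suc r) q (suc N))) ⟩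
    commonLimit r q                                               ∎
    where open ℚP.≤-Reasoning
  approximable : ∀ ε → 0ℚ < ε → ∃[ M ] commonLimit r q ≤ lhsPartial r q M + ε
  approximable ε 0<ε = M , ℚP.≤-trans (commonLimit≤lhsPartial+etaTerm r q M)
    (ℚP.+-monoʳ-≤ (lhsPartial r q M) (ℚP.≤-trans (etaTerm-bound r q M) (proj₂ small M ℕP.≤-refl)))
    where
    small = eventually-*inv≤ (fromℕ (length (comps (suc r) q))) ε 0<ε
    M = proj₁ small

rhsPartial-supremum : ∀ r q → IsSupremum (rhsPartial r q) (commonLimit r q)
rhsPartial-supremum r q = record
  { upperBound   = λ N → ℚP.≤-trans (rhoSum≤rhoLimit q r 0 0 N) (ℚP.≤-reflexive (rhoLimit-one r q))
  ; approximable = λ ε 0<ε → let (M , approx) = rhoLimit≤rhoSum+ε q r 0 0 ε 0<ε in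
      M , ℚP.≤-trans (ℚP.≤-reflexive (sym (rhoLimit-one r q))) (approx M ℕP.≤-refl)
  }

theorem3p1 : (r q : ℕ) →
    ((ε : ℚ) → 0ℚ < ε → (N : ℕ) → ∃[ M ] (lhsPartial r q N ≤ rhsPartial r q M + ε))
    × ((ε : ℚ) → 0ℚ < ε → (N : ℕ) → ∃[ M ] (rhsPartial r q N ≤ lhsPartial r q M + ε))
theorem3p1 r q = ≤-supremum+ε (lhsPartial-supremum r q) (rhsPartial-supremum r q)
               , ≤-supremum+ε (rhsPartial-supremum r q) (lhsPartial-supremum r q)
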